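{- Let $\phi=\frac{1+\sqrt5}{2}$ and let $L=\{(n,k)\in\mathbb{N}^2 \mid n/\phi \le k \le \phi n\}$ (so $L$ consists of $(0,0)$ together with the pairs of positive integers with $n/\phi<k<\phi n$), and $W=\mathbb{N}^2\setminus L$. In the two-heap game described below: (1) from every configuration in $W$ a player can make a move to a configuration in $L$; (2) from every configuration in $L$, every possible move leads to a configuration in $W$.
   Context: The two-heap game: a configuration is a pair $(A,B)$ of non-negative integers, the numbers of tokens in two heaps (the order of the heaps is immaterial). A move from $(A,B)$ consists of choosing one of the heaps and removing from it a positive number $t$ of tokens, at most the size of that heap, where $t$ is a multiple of $A$ or a multiple of $B$. The players alternate moves; $\mathbb{N}=\{0,1,2,\dots\}$. -}

module Defs where

open import Data.Nat using (ℕ; _+_; _*_; _∸_; _≤_; _<_)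
open import Data.Nat.Divisibility using (_∣_)
open import Data.Product using (_×_; ∃-syntax)
open import Data.Sum using (_⊎_)
open import Relation.Binary.PropositionalEquality using (_≡_)
open import Relation.Nullary using (¬_)

-- a ≤ φ·b  with φ = (1+√5)/2, for natural a, b.
-- a ≤ φ b  ⇔  2a − b ≤ b√5  ⇔  (2a ∸ b)² ≤ 5b²  (truncated subtraction
-- handles the case 2a ≤ b, where the inequality holds trivially).
_≤φ*_ : ℕ → ℕ → Set
a ≤φ* b = (2 * a ∸ b) * (2 * a ∸ b) ≤ 5 * (b * b)

-- L = {(n,k) | n/φ ≤ k ≤ φ n}; note n/φ ≤ k ⇔ n ≤ φ k.
InL : ℕ → ℕ → Set
InL n k = (n ≤φ* k) × (k ≤φ* n)

InW : ℕ → ℕ → Set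
InW n k = ¬ InL n k

Allowed : ℕ → ℕ → ℕ → Set
Allowed A B t = (0 < t) × ((A ∣ t) ⊎ (B ∣ t))

data Move (A B : ℕ) : ℕ → ℕ → Set where
  fromFirst  : (t : ℕ) → Allowed A B t → t ≤ A → Move A B (A ∸ t) B
  fromSecond : (t : ℕ) → Allowed A B t → t ≤ B → Move A B A (B ∸ t)

-- Since φ² = φ + 1, the bound a ≤ φ b is the square-free a² ≤ ab + b², and
-- φ n − n/φ = n: at a heap n > 0 the window [n/φ, φ n] of partners in L has
-- width n. From W some heap k exceeds φ n, and subtracting copies of n from it
-- lands in that window (for n = 0, remove all of k). From L, a positive
-- multiple of the heap n removed from n empties it, leaving (0, k) with k ≠ 0;
-- a positive multiple of k removed from n ≤ φ k = k + k/φ leaves at most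
-- n − k ≤ k/φ, and equality k = φ (n − k) is excluded because φ is irrational:
-- b² = bc + c² with b = c + d gives c² = cd + d², an infinite descent.
module Submission where

open import Defs
open import Data.Nat
open import Data.Nat.Properties
open import Data.Nat.Divisibility using (_∣_; ∣-refl; ∣⇒≤; 0∣⇒≡0; ∣m∣n⇒∣m+n)
open import Data.Nat.Induction using (<-wellFounded)
open import Data.Nat.Solver using (module +-*-Solver)
open import Data.Product using (_×_; _,_; ∃-syntax; proj₁; proj₂; map₂; swap)
open import Data.Product.Function.NonDependent.Propositional using (_×-⇔_)
open import Data.Sum using (inj₁; inj₂; reduce) renaming (swap to ⊎-swap)
open import Function using (_∘_; _⇔_; mk⇔; Equivalence)
open import Induction.WellFounded using (Acc; acc)
open import Relation.Binary using (Decidable)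
open import Relation.Binary.PropositionalEquality
open import Relation.Nullary using (¬_; yes; no; contradiction)
open import Relation.Nullary.Decidable using (decidable-stable)

open +-*-Solver
open Equivalence using (to; from)

private
  variable
    a b c k n t A B A′ B′ : ℕ

infix 4 _≤φ_ _φ≤_

_≤φ_ : ℕ → ℕ → Set
a ≤φ b = a * a ≤ a * b + b * b

-- φ a ≤ b, in the same square-free form.
_φ≤_ : ℕ → ℕ → Set
a φ≤ b = b * a + a * a ≤ b * b

_≤φ?_ : Decidable _≤φ_
a ≤φ? b = a * a ≤? a * b + b * b

≰φ⇒φ≤ : ¬ a ≤φ b → b φ≤ a
≰φ⇒φ≤ = <⇒≤ ∘ ≰⇒>

≤⇒≤φ : a ≤ b → a ≤φ b
≤⇒≤φ {a} {b} a≤b = ≤-trans (*-monoʳ-≤ a a≤b) (m≤m+n (a * b) (b * b))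

≰φ⇒> : ¬ a ≤φ b → b < a
≰φ⇒> {a} {b} a≰φb = ≰⇒> (a≰φb ∘ ≤⇒≤φ {a} {b})

≤φ-monoʳ : ∀ a → b ≤ c → a ≤φ b → a ≤φ c
≤φ-monoʳ {b} {c} a b≤c a≤φb =
  ≤-trans a≤φb (+-mono-≤ (*-monoʳ-≤ a b≤c) (*-mono-≤ b≤c b≤c))

≤φ0⇒≡0 : a ≤φ 0 → a ≡ 0
≤φ0⇒≡0 {zero}  _ = refl
≤φ0⇒≡0 {suc a} a≤φ0 with () ← subst (suc a * suc a ≤_) (trans (+-identityʳ _) (*-zeroʳ (suc a))) a≤φ0

+≤φ⇔φ≤ : ∀ k m → k + m ≤φ k ⇔ m φ≤ k
+≤φ⇔φ≤ k m = mk⇔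
  (λ h → +-cancelʳ-≤ X _ _ (subst₂ _≤_ square-expanded bound-expanded h))
  (λ h → subst₂ _≤_ (sym square-expanded) (sym bound-expanded) (+-monoˡ-≤ X h))
  where
  X = k * k + k * m
  square-expanded : (k + m) * (k + m) ≡ (k * m + m * m) + X
  square-expanded = solve 2 (λ k m → (k :+ m) :* (k :+ m) := (k :* m :+ m :* m) :+ (k :* k :+ k :* m)) refl k m
  bound-expanded : (k + m) * k + k * k ≡ k * k + X
  bound-expanded = solve 2 (λ k m → (k :+ m) :* k :+ k :* k := k :* k :+ (k :* k :+ k :* m)) refl k m

completeSquare : ∀ a b → b ≤ 2 * a → (2 * a ∸ b) * (2 * a ∸ b) + 4 * (a * b) ≡ 4 * (a * a) + b * b
completeSquare a b b≤2a = begin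
  d * d + 4 * (a * b)       ≡⟨ cong (d * d +_) (solve 2 (λ a b → con 4 :* (a :* b) := con 2 :* ((con 2 :* a) :* b)) refl a b) ⟩
  d * d + 2 * (2 * a * b)   ≡⟨ cong (λ x → d * d + 2 * (x * b)) d+b≡2a ⟨
  d * d + 2 * ((d + b) * b) ≡⟨ solve 2 (λ d b → d :* d :+ con 2 :* ((d :+ b) :* b) := (d :+ b) :* (d :+ b) :+ b :* b) refl d b ⟩
  (d + b) * (d + b) + b * b ≡⟨ cong (λ x → x * x + b * b) d+b≡2a ⟩
  2 * a * (2 * a) + b * b   ≡⟨ cong (_+ b * b) (solve 1 (λ a → (con 2 :* a) :* (con 2 :* a) := con 4 :* (a :* a)) refl a) ⟩
  4 * (a * a) + b * b       ∎
  where
  open ≡-Reasoning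
  d = 2 * a ∸ b
  d+b≡2a : d + b ≡ 2 * a
  d+b≡2a = m∸n+n≡m b≤2a

≤φ*⇔≤φ : a ≤φ* b ⇔ a ≤φ b
≤φ*⇔≤φ {a} {b} with 2 * a ≤? b
... | yes 2a≤b = mk⇔
  (λ _ → ≤⇒≤φ (≤-trans (m≤m+n a (a + 0)) 2a≤b))
  (λ _ → subst (λ d → d * d ≤ 5 * (b * b)) (sym (m≤n⇒m∸n≡0 2a≤b)) z≤n)
... | no 2a≰b = mk⇔
  (λ h → *-cancelˡ-≤ 4 (+-cancelʳ-≤ (b * b) _ _ (begin
    4 * (a * a) + b * b       ≡⟨ completeSquare a b b≤2a ⟨
    d * d + 4 * (a * b)       ≤⟨ +-monoˡ-≤ (4 * (a * b)) h ⟩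
    5 * (b * b) + 4 * (a * b) ≡⟨ regroup ⟩
    4 * (a * b + b * b) + b * b ∎)))
  (λ h → +-cancelʳ-≤ (4 * (a * b)) _ _ (begin
    d * d + 4 * (a * b)       ≡⟨ completeSquare a b b≤2a ⟩
    4 * (a * a) + b * b       ≤⟨ +-monoˡ-≤ (b * b) (*-monoʳ-≤ 4 h) ⟩
    4 * (a * b + b * b) + b * b ≡⟨ regroup ⟨
    5 * (b * b) + 4 * (a * b) ∎))
  where
  open ≤-Reasoning
  d = 2 * a ∸ b
  b≤2a : b ≤ 2 * a
  b≤2a = <⇒≤ (≰⇒> 2a≰b)
  regroup : 5 * (b * b) + 4 * (a * b) ≡ 4 * (a * b + b * b) + b * b
  regroup = solve 2 (λ a b → con 5 :* (b :* b) :+ con 4 :* (a :* b) := con 4 :* (a :* b :+ b :* b) :+ b :* b) refl a b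

InL⇔ : ∀ n k → InL n k ⇔ (n ≤φ k × k ≤φ n)
InL⇔ n k = ≤φ*⇔≤φ {n} {k} ×-⇔ ≤φ*⇔≤φ {k} {n}

golden-descent : ∀ {c d} → (c + d) * (c + d) ≡ (c + d) * c + c * c → c * c ≡ c * d + d * d
golden-descent {c} {d} eq = sym (+-cancelʳ-≡ (c * c + c * d) _ _ (begin
  (c * d + d * d) + (c * c + c * d) ≡⟨ solve 2 (λ c d → (c :* d :+ d :* d) :+ (c :* c :+ c :* d) := (c :+ d) :* (c :+ d)) refl c d ⟩
  (c + d) * (c + d)                 ≡⟨ eq ⟩
  (c + d) * c + c * c               ≡⟨ solve 2 (λ c d → (c :+ d) :* c :+ c :* c := c :* c :+ (c :* c :+ c :* d)) refl c d ⟩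
  c * c + (c * c + c * d)           ∎))
  where open ≡-Reasoning

b*b≡b*c+c*c⇒b≡0 : b * b ≡ b * c + c * c → b ≡ 0
b*b≡b*c+c*c⇒b≡0 {b} = descent (<-wellFounded b)
  where
  descent : ∀ {b c} → Acc _<_ b → b * b ≡ b * c + c * c → b ≡ 0
  descent {b} {c} (acc smaller) eq = ≤φ0⇒≡0 (subst (b ≤φ_) c≡0 (≤-reflexive eq))
    where
    c≡0 : c ≡ 0
    c≡0 with b ≤? c
    ... | yes b≤c = reduce (m*n≡0⇒m≡0∨n≡0 c (n≤0⇒n≡0 (+-cancelˡ-≤ (b * c) _ _ (begin
      b * c + c * c ≡⟨ eq ⟨
      b * b         ≤⟨ *-monoʳ-≤ b b≤c ⟩
      b * c         ≡⟨ +-identityʳ (b * c) ⟨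
      b * c + 0     ∎))))
      where open ≤-Reasoning
    ... | no b≰c = descent (smaller c<b) (golden-descent {c} {d} (subst (λ x → x * x ≡ x * c + c * c) (sym c+d≡b) eq))
      where
      c<b = ≰⇒> b≰c
      d = b ∸ c
      c+d≡b : c + d ≡ b
      c+d≡b = m+[n∸m]≡n (<⇒≤ c<b)

≤φ∧φ≤⇒≡0 : ∀ k m → k ≤φ m → m φ≤ k → k ≡ 0
≤φ∧φ≤⇒≡0 k m k≤φm m≤φk = b*b≡b*c+c*c⇒b≡0 (≤-antisym k≤φm m≤φk)

Allowed-swap : Allowed A B t → Allowed B A t
Allowed-swap = map₂ ⊎-swap

Move-swap : Move A B A′ B′ → Move B A B′ A′
Move-swap (fromFirst  t allowed t≤A) = fromSecond t (Allowed-swap allowed) t≤A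
Move-swap (fromSecond t allowed t≤B) = fromFirst  t (Allowed-swap allowed) t≤B

removeSecond : ∀ {k′} → k′ + t ≡ k → Allowed n k t → Move n k n k′
removeSecond {t} {n = n} {k′} refl allowed =
  subst (Move n (k′ + t) n) (m+n∸n≡m k′ t) (fromSecond t allowed (m≤n+m t k′))

≤φ-removeFirst : n ≤φ k → Allowed n k t → t ≤ n → ¬ k ≤φ (n ∸ t)
≤φ-removeFirst {n} {k} {t} n≤φk (0<t , inj₁ n∣t) t≤n k≤φn∸t = <⇒≱ 0<t (subst (t ≤_) n≡0 t≤n)
  where
  k≡0 : k ≡ 0
  k≡0 = ≤φ0⇒≡0 (subst (k ≤φ_) (m≤n⇒m∸n≡0 (∣⇒≤ {{>-nonZero 0<t}} n∣t)) k≤φn∸t)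
  n≡0 : n ≡ 0
  n≡0 = ≤φ0⇒≡0 (subst (n ≤φ_) k≡0 n≤φk)
≤φ-removeFirst {n} {k} {t} n≤φk (0<t , inj₂ k∣t) t≤n k≤φn∸t = n>0⇒n≢0 0<t (0∣⇒≡0 (subst (_∣ t) k≡0 k∣t))
  where
  k≤t : k ≤ t
  k≤t = ∣⇒≤ {{>-nonZero 0<t}} k∣t
  k≡0 : k ≡ 0
  k≡0 = ≤φ∧φ≤⇒≡0 k (n ∸ k) (≤φ-monoʳ k (∸-monoʳ-≤ n k≤t) k≤φn∸t)
          (to (+≤φ⇔φ≤ k (n ∸ k)) (subst (_≤φ k) (sym (m+[n∸m]≡n (≤-trans k≤t t≤n))) n≤φk))

L⇒movesToW : InL n k → Move n k A′ B′ → InW A′ B′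
L⇒movesToW {n} {k} {A′} {B′} l (fromFirst t allowed t≤n) l′ =
  ≤φ-removeFirst (proj₁ (to (InL⇔ n k) l)) allowed t≤n (proj₂ (to (InL⇔ A′ B′) l′))
L⇒movesToW {n} {k} {A′} {B′} l (fromSecond t allowed t≤k) l′ =
  ≤φ-removeFirst (proj₂ (to (InL⇔ n k) l)) (Allowed-swap allowed) t≤k (proj₁ (to (InL⇔ A′ B′) l′))

descend : 0 < n → Acc _<_ k → ¬ k ≤φ n →
          ∃[ k′ ] ∃[ t ] ((k′ + t ≡ k × 0 < t × n ∣ t) × (n ≤φ k′ × k′ ≤φ n))
descend {n} {k} 0<n (acc smaller) k≰φn
  with k₁ , refl ← m≤n⇒∃[o]m+o≡n {n} {k} (<⇒≤ (≰φ⇒> k≰φn))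
  with k₁ ≤φ? n
... | yes k₁≤φn = k₁ , n , (+-comm k₁ n , 0<n , ∣-refl) , (n≤φk₁ , k₁≤φn)
  where
  n≤φk₁ : n ≤φ k₁
  n≤φk₁ = decidable-stable (n ≤φ? k₁) (λ n≰φk₁ → k≰φn (from (+≤φ⇔φ≤ n k₁) (≰φ⇒φ≤ {n} {k₁} n≰φk₁)))
... | no k₁≰φn with descend 0<n (smaller (m<n+m k₁ 0<n)) k₁≰φn
...   | k′ , t , (k′+t≡k₁ , 0<t , n∣t) , l =
  k′ , t + n , (k′+[t+n]≡n+k₁ , ≤-trans 0<t (m≤m+n t n) , ∣m∣n⇒∣m+n n∣t ∣-refl) , l
  where
  open ≡-Reasoning
  k′+[t+n]≡n+k₁ : k′ + (t + n) ≡ n + k₁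
  k′+[t+n]≡n+k₁ = begin
    k′ + (t + n) ≡⟨ +-assoc k′ t n ⟨
    k′ + t + n   ≡⟨ cong (_+ n) k′+t≡k₁ ⟩
    k₁ + n       ≡⟨ +-comm k₁ n ⟩
    n + k₁       ∎

moveSecondToL : ¬ k ≤φ n → ∃[ k′ ] (Move n k n k′ × InL n k′)
moveSecondToL {zero}  {n = zero}  k≰φ0 = contradiction z≤n k≰φ0
moveSecondToL {suc k} {n = zero}  _    = 0 , removeSecond refl (z<s , inj₂ ∣-refl) , (z≤n , z≤n)
moveSecondToL {k} {n = suc n} k≰φn with descend z<s (<-wellFounded k) k≰φn
... | k′ , t , (k′+t≡k , 0<t , n∣t) , l = k′ , removeSecond k′+t≡k (0<t , inj₁ n∣t) , from (InL⇔ (suc n) k′) l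

W⇒moveToL : InW n k → ∃[ n′ ] ∃[ k′ ] (Move n k n′ k′ × InL n′ k′)
W⇒moveToL {n} {k} w with n ≤φ? k | k ≤φ? n
... | yes n≤φk | yes k≤φn = contradiction (from (InL⇔ n k) (n≤φk , k≤φn)) w
... | _        | no k≰φn  = let k′ , move , l = moveSecondToL k≰φn in n , k′ , move , l
... | no n≰φk  | yes _    = let n′ , move , l = moveSecondToL n≰φk in n′ , k , Move-swap move , swap l

proposition1 : ((n k : ℕ) → InW n k → ∃[ n' ] ∃[ k' ] (Move n k n' k' × InL n' k'))
                 × ((n k : ℕ) → InL n k → (n' k' : ℕ) → Move n k n' k' → InW n' k')
proposition1 = (λ _ _ → W⇒moveToL) , (λ _ _ l _ _ → L⇒movesToW l)
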